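{- Let $T\subseteq\omega^{<\omega}$ be a tree and $\mathcal{A}(T)=(G,(f_a)_{a\in G})$ the associated structure. For any tuple $\overline{a}$ in $\mathcal{A}(T)$, if $n$ is greatest such that some entry of $\overline{a}$ lies in $G_n$, then $SR(\overline{a})=SR(id_n)$.
   Context: For a tree $T\subseteq\omega^{<\omega}$ let $T_n$ be the set of nodes of length $n$. $G_n$ is the set of finite subsets of $T_n$, an abelian group under symmetric difference $\triangle$; for distinct $n>0$ the empty set in $G_n$ is replaced by distinct new elements $id_n$, and $G_0=\{id_0\}$. $G=\bigcup_n G_n$. The predecessor map $p:G_{n+1}\to G_n$: for nonempty $a=\{t_1,\dots,t_k\}\in G_{n+1}$ with $t_j'$ the predecessor of $t_j$ in $T$, $p(a)=\{t_1'\}\triangle\cdots\triangle\{t_k'\}$ (with $\emptyset$ written $id_n$), and $p(id_{n+1})=id_n$. For $a\in G_n$, $b\in G_m$, let $k=\min\{m,n\}$, $a^*=p^{(n-k)}(a)$, $b^*=p^{(m-k)}(b)$, and $f_a(b)=a^*\triangle b^*$. $\mathcal{A}(T)=(G,(f_a)_{a\in G})$. Back-and-forth relations: $\overline{a}\equiv^0\overline{b}$ iff same quantifier-free formulas; for $\beta>0$, $\overline{a}\equiv^\beta\overline{b}$ iff for every $\gamma<\beta$, for every $c$ there is $d$ and for every $d$ there is $c$ with $\overline{a},c\equiv^\gamma\overline{b},d$. $SR(\overline{a})$ is the least $\beta$ such that every $\overline{b}$ with $\overline{a}\equiv^\beta\overline{b}$ is in the automorphism orbit of $\overline{a}$. 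-}

module Defs where

open import Data.Nat using (ℕ; zero; suc; _≤_; _⊓_; _∸_; _<ᵇ_)
open import Data.Bool using (Bool; true; false; if_then_else_)
open import Data.List using (List; []; _∷_; foldr; length; _∷ʳ_)
open import Data.List.Relation.Unary.All using (All)
open import Data.List.Relation.Unary.Linked using (Linked)
open import Data.Vec using (Vec; lookup) renaming (_∷ʳ_ to _∷ᵛ_)
open import Data.Vec.Relation.Unary.All using () renaming (All to AllV)
open import Data.Fin using (Fin)
open import Data.Product using (Σ; _×_; _,_; proj₁; proj₂; ∃)
open import Data.Unit using (⊤)
open import Data.Empty using (⊥)
open import Relation.Binary.PropositionalEquality using (_≡_)

Node : Set
Node = List ℕ

record Tree : Set where
  field
    mem    : Node → Bool
    closed : ∀ (s : Node) (x : ℕ) → mem (s ∷ʳ x) ≡ true → mem s ≡ true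
open Tree public

-- Lexicographic comparison of nodes (used to keep finite sets canonical)

data Cmp : Set where
  lt eq gt : Cmp

cmpℕ : ℕ → ℕ → Cmp
cmpℕ zero    zero    = eq
cmpℕ zero    (suc _) = lt
cmpℕ (suc _) zero    = gt
cmpℕ (suc m) (suc n) = cmpℕ m n

cmp : Node → Node → Cmp
cmp []       []       = eq
cmp []       (_ ∷ _)  = lt
cmp (_ ∷ _)  []       = gt
cmp (x ∷ xs) (y ∷ ys) with cmpℕ x y
... | lt = lt
... | gt = gt
... | eq = cmp xs ys

toggle : Node → List Node → List Node
toggle x [] = x ∷ []
toggle x (y ∷ ys) with cmp x y
... | lt = x ∷ y ∷ ys
... | eq = ys
... | gt = y ∷ toggle x ys

_△_ : List Node → List Node → List Node
a △ b = foldr toggle b a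

dropLast : Node → Node
dropLast []           = []
dropLast (x ∷ [])     = []
dropLast (x ∷ y ∷ ys) = x ∷ dropLast (y ∷ ys)

-- Elements of G.  A raw element is (n , a): the level n and a finite
-- subset a of T_n, given as a strictly lex-increasing list; the empty
-- list at level n is id_n.

Raw : Set
Raw = ℕ × List Node

level : Raw → ℕ
level = proj₁

id : ℕ → Raw
id n = (n , [])

Valid : Tree → Raw → Set
Valid T (zero  , a) = a ≡ []
Valid T (suc n , a) =
  All (λ t → (length t ≡ suc n) × (mem T t ≡ true)) a ×
  Linked (λ s t → cmp s t ≡ lt) a

p : Raw → Raw
p (zero        , a) = (zero , [])
p (suc zero    , a) = (zero , [])
p (suc (suc n) , a) = (suc n , foldr (λ t acc → (dropLast t ∷ []) △ acc) [] a)

pIter : ℕ → Raw → Raw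
pIter zero    x = x
pIter (suc k) x = p (pIter k x)

f : Raw → Raw → Raw
f a b = (k , proj₂ (pIter (level a ∸ k) a) △ proj₂ (pIter (level b ∸ k) b))
  where k = level a ⊓ level b

data Term (T : Tree) (k : ℕ) : Set where
  var : Fin k → Term T k
  app : (a : Raw) → Valid T a → Term T k → Term T k

eval : ∀ {T k} → Term T k → Vec Raw k → Raw
eval (var i)     ρ = lookup ρ i
eval (app a _ t) ρ = f a (eval t ρ)

_⟺_ : Set → Set → Set
A ⟺ B = (A → B) × (B → A)

-- ā ≡^0 b̄ : same quantifier-free formulas (atomic formulas are t = s)
QFEq : (T : Tree) {k : ℕ} → Vec Raw k → Vec Raw k → Set
QFEq T {k} as bs = ∀ (s t : Term T k) → (eval s as ≡ eval t as) ⟺ (eval s bs ≡ eval t bs)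

data Ord : Set where
  oz : Ord
  os : Ord → Ord
  ol : (ℕ → Ord) → Ord

mutual
  _≤ₒ_ : Ord → Ord → Set
  oz   ≤ₒ b = ⊤
  os a ≤ₒ b = a <ₒ b
  ol g ≤ₒ b = ∀ n → g n ≤ₒ b

  _<ₒ_ : Ord → Ord → Set
  a <ₒ oz   = ⊥
  a <ₒ os b = a ≤ₒ b
  a <ₒ ol g = ∃ λ n → a <ₒ g n

Step : (T : Tree) → (∀ {k} → Vec Raw k → Vec Raw k → Set) →
       ∀ {k} → Vec Raw k → Vec Raw k → Set
Step T R as bs =
  (∀ c → Valid T c → ∃ λ d → Valid T d × R (as ∷ᵛ c) (bs ∷ᵛ d)) ×
  (∀ d → Valid T d → ∃ λ c → Valid T c × R (as ∷ᵛ c) (bs ∷ᵛ d))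

-- ≡^β.  ≡^{β+1} = ∀γ≤β Step(≡^γ) is unfolded as Step(≡^β) ∧ ≡^β,
-- ≡^{sup f} = ∀γ<sup f Step(≡^γ) is unfolded as ∀ n, ≡^{f n}.
BF : (T : Tree) → Ord → ∀ {k} → Vec Raw k → Vec Raw k → Set
BF T oz       as bs = QFEq T as bs
BF T (os β)   as bs = Step T (BF T β) as bs × BF T β as bs
BF T (ol g)   as bs = ∀ n → BF T (g n) as bs

record Automorphism (T : Tree) : Set where
  field
    σ      : Raw → Raw
    valid  : ∀ x → Valid T x → Valid T (σ x)
    inj    : ∀ x y → Valid T x → Valid T y → σ x ≡ σ y → x ≡ y
    surj   : ∀ y → Valid T y → ∃ λ x → Valid T x × σ x ≡ y
    hom    : ∀ a b → Valid T a → Valid T b → σ (f a b) ≡ f a (σ b)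

InOrbit : (T : Tree) {k : ℕ} → Vec Raw k → Vec Raw k → Set
InOrbit T as bs = Σ (Automorphism T) λ A → Data.Vec.map (Automorphism.σ A) as ≡ bs

SRCond : (T : Tree) {k : ℕ} → Vec Raw k → Ord → Set
SRCond T {k} as β = ∀ (bs : Vec Raw k) → AllV (Valid T) bs → BF T β as bs → InOrbit T as bs

IsSR : (T : Tree) {k : ℕ} → Vec Raw k → Ord → Set
IsSR T as β = SRCond T as β × (∀ γ → SRCond T as γ → β ≤ₒ γ)

{-# OPTIONS --safe #-}

-- Each G_n is a vector space over 𝔽₂ under △, the predecessor map is linear, and f_a(b) only
-- depends on the images of a and b at the lower of their two levels.  If ā ≡⁰ b̄, the differences
-- e_i = a_i △ b_i are coherent: any two of them have the same image at every common level.
-- Translating a tuple by a coherent family of the same levels preserves quantifier-free types, and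
-- this is stable under the back-and-forth extensions, so ā ≡^β b̄ gives ū ≡^β ū △ ē for every ū
-- with the levels of ā; term-definable maps preserve ≡^β as well.  With ū = (id_{level a_i})_i and
-- a top-level entry a_i this turns ā ≡^β b̄ into id_n ≡^β e_i, and conversely id_n ≡^β e into
-- ā ≡^β ā △ (images of e at the levels of ā).  An automorphism σ is determined by σ(id_n), since
-- σ(id_l) = f_{id_l}(σ(id_n)) for l ≤ n and σ(a) = f_a(σ(id_{level a})); so an automorphism
-- witnessing one orbit condition yields one for the other, and ā and id_n satisfy the Scott-rank
-- condition for exactly the same β.

module Submission where

open import Defs
open import Data.Nat using (ℕ; _≤_)
open import Data.Vec using (Vec; []; _∷_)
open import Data.Vec.Relation.Unary.All using (All)
open import Data.Vec.Relation.Unary.Any using (Any)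
open import Relation.Binary.PropositionalEquality using (_≡_)

open import Data.Bool using (Bool; true; false; not; _xor_)
open import Data.Bool.Properties using (not-involutive; xor-assoc; xor-comm; xor-same; xor-identityʳ)
open import Data.Empty using (⊥)
open import Data.Fin using (Fin; zero; suc; fromℕ; inject₁)
open import Data.List using (List; []; _∷_; foldr; length; initLast; _∷ʳ′_) renaming (_∷ʳ_ to _∷ʳˡ_)
import Data.List.Properties as List
open import Data.List.Relation.Unary.All as ListAll using ([]; _∷_)
open import Data.List.Relation.Unary.AllPairs using (AllPairs; []; _∷_)
open import Data.List.Relation.Unary.Linked using (Linked)
open import Data.List.Relation.Unary.Linked.Properties using (AllPairs⇒Linked; Linked⇒AllPairs)
import Data.Nat as ℕ
open import Data.Nat using (zero; suc; pred; _+_; _∸_; _⊓_)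
open import Data.Nat.Properties
  using (≤-refl; ≤-reflexive; ≤-trans; ≤-antisym; +-comm; +-∸-assoc; m∸n+n≡m; m∸[m∸n]≡n; n∸n≡0;
         pred[m∸n]≡m∸[1+n]; m≤n⇒m⊓n≡m; m≥n⇒m⊓n≡n; m⊓n≤m; m⊓n≤n; m⊓n≡n⇒n≤m; suc-injective)
open import Data.Product using (_,_; _×_; ∃; proj₁; proj₂)
open import Data.Vec using (lookup; map; zipWith; _∷ʳ_)
open import Data.Vec.Properties
  using (lookup-map; lookup-zipWith; map-∷ʳ; map-∘; ∷-injectiveˡ; tabulate∘lookup; tabulate-cong)
open import Data.Vec.Relation.Unary.All as VecAll using ([]; _∷_)
open import Data.Vec.Relation.Unary.All.Properties using (lookup⁺; map⁺)
import Data.Vec.Relation.Unary.Any as Any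
open import Data.Vec.Relation.Unary.Any.Properties using (lookup-index)
open import Relation.Binary.Definitions using (DecidableEquality)
open import Relation.Binary.PropositionalEquality
  using (refl; sym; trans; cong; cong₂; subst; subst₂; module ≡-Reasoning)
open import Relation.Nullary using (does)
open import Relation.Nullary.Decidable using (dec-true; dec-false)

xor-cancelˡ : ∀ a b → a xor (a xor b) ≡ b
xor-cancelˡ false b = refl
xor-cancelˡ true  b = not-involutive b

xor-injectiveˡ : ∀ a {b c} → a xor b ≡ a xor c → b ≡ c
xor-injectiveˡ a {b} {c} h = trans (sym (xor-cancelˡ a b)) (trans (cong (a xor_) h) (xor-cancelˡ a c))

xor-injectiveʳ : ∀ {a b} c → a xor c ≡ b xor c → a ≡ b
xor-injectiveʳ {a} {b} c h = xor-injectiveˡ c (trans (xor-comm c a) (trans h (xor-comm b c)))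

xor-swap : ∀ a b c → a xor (b xor c) ≡ b xor (a xor c)
xor-swap a b c = trans (sym (xor-assoc a b c)) (trans (cong (_xor c) (xor-comm a b)) (xor-assoc b a c))

xor-exchange : ∀ a b c d → a xor d ≡ c xor b → a xor b ≡ c xor d
xor-exchange false b false d h = sym h
xor-exchange true  b true  d h = sym h
xor-exchange false b true  d h = trans (sym (not-involutive b)) (cong not (sym h))
xor-exchange true  b false d h = trans (cong not (sym h)) (not-involutive d)

lookup-∷ʳ-last : ∀ {A : Set} {k} (u : Vec A k) c → lookup (u ∷ʳ c) (fromℕ k) ≡ c
lookup-∷ʳ-last []      c = refl
lookup-∷ʳ-last (x ∷ u) c = lookup-∷ʳ-last u c

lookup-∷ʳ-inject₁ : ∀ {A : Set} {k} (u : Vec A k) c i → lookup (u ∷ʳ c) (inject₁ i) ≡ lookup u i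
lookup-∷ʳ-inject₁ (x ∷ u) c zero    = refl
lookup-∷ʳ-inject₁ (x ∷ u) c (suc i) = lookup-∷ʳ-inject₁ u c i

All-∷ʳ : ∀ {A : Set} {P : A → Set} {k} {u : Vec A k} {c} → All P u → P c → All P (u ∷ʳ c)
All-∷ʳ []        pc = pc ∷ []
All-∷ʳ (px ∷ pu) pc = px ∷ All-∷ʳ pu pc

zipWith-∷ʳ : ∀ {A B C : Set} (g : A → B → C) {k} (u : Vec A k) (v : Vec B k) c d →
             zipWith g (u ∷ʳ c) (v ∷ʳ d) ≡ zipWith g u v ∷ʳ g c d
zipWith-∷ʳ g []      []      c d = refl
zipWith-∷ʳ g (x ∷ u) (y ∷ v) c d = cong (g x y ∷_) (zipWith-∷ʳ g u v c d)

≡-lookup : ∀ {A : Set} {k} {u v : Vec A k} → (∀ i → lookup u i ≡ lookup v i) → u ≡ v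
≡-lookup {u = u} {v} h = trans (sym (tabulate∘lookup u)) (trans (tabulate-cong h) (tabulate∘lookup v))

cmpℕ-refl : ∀ m → cmpℕ m m ≡ eq
cmpℕ-refl zero    = refl
cmpℕ-refl (suc m) = cmpℕ-refl m

cmpℕ-eq⇒≡ : ∀ m n → cmpℕ m n ≡ eq → m ≡ n
cmpℕ-eq⇒≡ zero    zero    _  = refl
cmpℕ-eq⇒≡ (suc m) (suc n) mn = cong suc (cmpℕ-eq⇒≡ m n mn)

cmpℕ-gt⇒lt : ∀ m n → cmpℕ m n ≡ gt → cmpℕ n m ≡ lt
cmpℕ-gt⇒lt (suc m) zero    _  = refl
cmpℕ-gt⇒lt (suc m) (suc n) mn = cmpℕ-gt⇒lt m n mn

cmpℕ-trans : ∀ m n o → cmpℕ m n ≡ lt → cmpℕ n o ≡ lt → cmpℕ m o ≡ lt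
cmpℕ-trans zero    (suc n) (suc o) _  _  = refl
cmpℕ-trans (suc m) (suc n) (suc o) mn no = cmpℕ-trans m n o mn no

cmp-refl : ∀ s → cmp s s ≡ eq
cmp-refl []      = refl
cmp-refl (x ∷ s) rewrite cmpℕ-refl x = cmp-refl s

cmp-eq⇒≡ : ∀ s t → cmp s t ≡ eq → s ≡ t
cmp-eq⇒≡ []      []      _  = refl
cmp-eq⇒≡ (x ∷ s) (y ∷ t) st with cmpℕ x y in xy
... | eq = cong₂ _∷_ (cmpℕ-eq⇒≡ x y xy) (cmp-eq⇒≡ s t st)

cmp-gt⇒lt : ∀ s t → cmp s t ≡ gt → cmp t s ≡ lt
cmp-gt⇒lt (x ∷ s) []      _  = refl
cmp-gt⇒lt (x ∷ s) (y ∷ t) st with cmpℕ x y in xy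
... | gt rewrite cmpℕ-gt⇒lt x y xy = refl
... | eq rewrite cmpℕ-eq⇒≡ x y xy | cmpℕ-refl y = cmp-gt⇒lt s t st

cmp-trans : ∀ s t u → cmp s t ≡ lt → cmp t u ≡ lt → cmp s u ≡ lt
cmp-trans []      (y ∷ t) (z ∷ u) _  _  = refl
cmp-trans (x ∷ s) (y ∷ t) (z ∷ u) st tu with cmpℕ x y in xy | cmpℕ y z in yz
... | lt | lt rewrite cmpℕ-trans x y z xy yz = refl
... | lt | eq rewrite sym (cmpℕ-eq⇒≡ y z yz) | xy = refl
... | eq | lt rewrite cmpℕ-eq⇒≡ x y xy | yz = refl
... | eq | eq rewrite cmpℕ-eq⇒≡ x y xy | cmpℕ-eq⇒≡ y z yz | cmpℕ-refl z = cmp-trans s t u st tu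

_≺_ : Node → Node → Set
s ≺ t = cmp s t ≡ lt

≺-irrefl : ∀ s → s ≺ s → ⊥
≺-irrefl s s≺s with () ← trans (sym (cmp-refl s)) s≺s

Sorted : List Node → Set
Sorted = AllPairs _≺_

Linked⇒Sorted : ∀ {l} → Linked _≺_ l → Sorted l
Linked⇒Sorted = Linked⇒AllPairs (λ {s} {t} {u} → cmp-trans s t u)

toggle-All : ∀ {P : Node → Set} {x} l → P x → ListAll.All P l → ListAll.All P (toggle x l)
toggle-All         []      px []        = px ∷ []
toggle-All {x = x} (y ∷ l) px (py ∷ pl) with cmp x y
... | lt = px ∷ py ∷ pl
... | eq = pl
... | gt = py ∷ toggle-All l px pl

△-All : ∀ {P : Node → Set} a {b} → ListAll.All P a → ListAll.All P b → ListAll.All P (a △ b)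
△-All []      _         pb = pb
△-All (t ∷ a) (pt ∷ pa) pb = toggle-All (a △ _) pt (△-All a pa pb)

toggle-sorted : ∀ x {l} → Sorted l → Sorted (toggle x l)
toggle-sorted x {[]}    []          = [] ∷ []
toggle-sorted x {y ∷ l} (y≺l ∷ sl) with cmp x y in xy
... | lt = (xy ∷ ListAll.map (λ {z} → cmp-trans x y z xy) y≺l) ∷ y≺l ∷ sl
... | eq = sl
... | gt = toggle-All l (cmp-gt⇒lt x y xy) y≺l ∷ toggle-sorted x sl

△-sorted : ∀ a {b} → Sorted b → Sorted (a △ b)
△-sorted []      sb = sb
△-sorted (t ∷ a) sb = toggle-sorted t (△-sorted a sb)

_≟ₙ_ : DecidableEquality Node
_≟ₙ_ = List.≡-dec ℕ._≟_

-- △ acts on parities as pointwise xor, and a sorted list is determined by its parities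
-- (parity-injective), so the group laws of △ on sorted lists reduce to those of xor.
parityOf : (Node → Node) → List Node → Node → Bool
parityOf g l s = foldr (λ t b → does (g t ≟ₙ s) xor b) false l

parity : List Node → Node → Bool
parity = parityOf (λ t → t)

toggle-parity : ∀ g x l s → parityOf g (toggle x l) s ≡ does (g x ≟ₙ s) xor parityOf g l s
toggle-parity g x []      s = refl
toggle-parity g x (y ∷ l) s with cmp x y in xy
... | lt = refl
... | eq rewrite cmp-eq⇒≡ x y xy = sym (xor-cancelˡ (does (g y ≟ₙ s)) (parityOf g l s))
... | gt rewrite toggle-parity g x l s = xor-swap (does (g y ≟ₙ s)) (does (g x ≟ₙ s)) (parityOf g l s)

△-parityOf : ∀ g a b s → parityOf g (a △ b) s ≡ parityOf g a s xor parityOf g b s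
△-parityOf g []      b s = refl
△-parityOf g (t ∷ a) b s rewrite toggle-parity g t (a △ b) s | △-parityOf g a b s =
  sym (xor-assoc (does (g t ≟ₙ s)) (parityOf g a s) (parityOf g b s))

△-parity : ∀ a b s → parity (a △ b) s ≡ parity a s xor parity b s
△-parity = △-parityOf (λ t → t)

parity-absent : ∀ {s} l → ListAll.All (s ≺_) l → parity l s ≡ false
parity-absent         []      []          = refl
parity-absent {s} (t ∷ l) (s≺t ∷ s≺l)
  rewrite dec-false (t ≟ₙ s) (λ { refl → ≺-irrefl s s≺t }) = parity-absent l s≺l

parity-head : ∀ {s l} → Sorted (s ∷ l) → parity (s ∷ l) s ≡ true
parity-head {s} {l} (s≺l ∷ _) =
  trans (cong (_xor parity l s) (dec-true (s ≟ₙ s) refl)) (cong not (parity-absent l s≺l))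

parity-below : ∀ {s t l} → s ≺ t → Sorted (t ∷ l) → parity (t ∷ l) s ≡ false
parity-below {s} {t} {l} s≺t (t≺l ∷ _) =
  parity-absent (t ∷ l) (s≺t ∷ ListAll.map (λ {u} → cmp-trans s t u s≺t) t≺l)

parity-injective : ∀ {l₁ l₂} → Sorted l₁ → Sorted l₂ →
                   (∀ s → parity l₁ s ≡ parity l₂ s) → l₁ ≡ l₂
parity-injective {[]}    {[]}    _  _  _ = refl
parity-injective {[]}    {t ∷ _} _  s₂ h with () ← trans (h t) (parity-head s₂)
parity-injective {s ∷ _} {[]}    s₁ _  h with () ← trans (sym (h s)) (parity-head s₁)
parity-injective {s ∷ _} {t ∷ _} s₁@(_ ∷ s₁′) s₂@(_ ∷ s₂′) h with cmp s t in st
... | lt with () ← trans (sym (parity-head s₁)) (trans (h s) (parity-below st s₂))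
... | gt with () ← trans (sym (parity-head s₂)) (trans (sym (h t)) (parity-below (cmp-gt⇒lt s t st) s₁))
... | eq with refl ← cmp-eq⇒≡ s t st =
  cong (s ∷_) (parity-injective s₁′ s₂′ (λ u → xor-injectiveˡ (does (s ≟ₙ u)) (h u)))

△-identityʳ : ∀ {a} → Sorted a → a △ [] ≡ a
△-identityʳ {a} sa = parity-injective (△-sorted a []) sa λ s →
  trans (△-parity a [] s) (xor-identityʳ (parity a s))

△-self : ∀ {a} → Sorted a → a △ a ≡ []
△-self {a} sa = parity-injective (△-sorted a sa) [] λ s →
  trans (△-parity a a s) (xor-same (parity a s))

△-cancelˡ : ∀ a {b} → Sorted b → a △ (a △ b) ≡ b
△-cancelˡ a {b} sb = parity-injective (△-sorted a (△-sorted a sb)) sb λ s → begin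
  parity (a △ (a △ b)) s                     ≡⟨ △-parity a (a △ b) s ⟩
  parity a s xor parity (a △ b) s            ≡⟨ cong (parity a s xor_) (△-parity a b s) ⟩
  parity a s xor (parity a s xor parity b s) ≡⟨ xor-cancelˡ (parity a s) (parity b s) ⟩
  parity b s                                 ∎
  where open ≡-Reasoning

△-comm : ∀ {a b} → Sorted a → Sorted b → a △ b ≡ b △ a
△-comm {a} {b} sa sb = parity-injective (△-sorted a sb) (△-sorted b sa) λ s → begin
  parity (a △ b) s                ≡⟨ △-parity a b s ⟩
  parity a s xor parity b s       ≡⟨ xor-comm (parity a s) (parity b s) ⟩
  parity b s xor parity a s       ≡⟨ △-parity b a s ⟨
  parity (b △ a) s                ∎
  where open ≡-Reasoning

△-assoc : ∀ a b {c} → Sorted c → (a △ b) △ c ≡ a △ (b △ c)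
△-assoc a b {c} sc = parity-injective (△-sorted (a △ b) sc) (△-sorted a (△-sorted b sc)) λ s → begin
  parity ((a △ b) △ c) s                       ≡⟨ △-parity (a △ b) c s ⟩
  parity (a △ b) s xor parity c s              ≡⟨ cong (_xor parity c s) (△-parity a b s) ⟩
  (parity a s xor parity b s) xor parity c s   ≡⟨ xor-assoc (parity a s) (parity b s) (parity c s) ⟩
  parity a s xor (parity b s xor parity c s)   ≡⟨ cong (parity a s xor_) (△-parity b c s) ⟨
  parity a s xor parity (b △ c) s              ≡⟨ △-parity a (b △ c) s ⟨
  parity (a △ (b △ c)) s                       ∎
  where open ≡-Reasoning

△-cancelʳ : ∀ {a b} c → Sorted a → Sorted b → a △ c ≡ b △ c → a ≡ b
△-cancelʳ {a} {b} c sa sb h = parity-injective sa sb λ s → xor-injectiveʳ (parity c s)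
  (trans (sym (△-parity a c s)) (trans (cong (λ l → parity l s) h) (△-parity b c s)))

△-exchange : ∀ a {b} c {d} → Sorted b → Sorted d → a △ d ≡ c △ b → a △ b ≡ c △ d
△-exchange a {b} c {d} sb sd h = parity-injective (△-sorted a sb) (△-sorted c sd) λ s →
  trans (△-parity a b s) (trans (xor-exchange (parity a s) (parity b s) (parity c s) (parity d s)
    (trans (sym (△-parity a d s)) (trans (cong (λ l → parity l s) h) (△-parity c b s))))
  (sym (△-parity c d s)))

-- The list part of p at levels ≥ 2, written so that p (2 + n , a) ≡ (1 + n , predecessors a) holds by refl.
predecessors : List Node → List Node
predecessors a = foldr (λ t acc → (dropLast t ∷ []) △ acc) [] a

predecessors-sorted : ∀ a → Sorted (predecessors a)
predecessors-sorted []      = []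
predecessors-sorted (t ∷ a) = toggle-sorted (dropLast t) (predecessors-sorted a)

parity-predecessors : ∀ a s → parity (predecessors a) s ≡ parityOf dropLast a s
parity-predecessors []      s = refl
parity-predecessors (t ∷ a) s =
  trans (toggle-parity (λ u → u) (dropLast t) (predecessors a) s)
        (cong (does (dropLast t ≟ₙ s) xor_) (parity-predecessors a s))

predecessors-△ : ∀ a b → predecessors (a △ b) ≡ predecessors a △ predecessors b
predecessors-△ a b = parity-injective (predecessors-sorted (a △ b)) (△-sorted A (predecessors-sorted b)) λ s →
  begin
    parity (predecessors (a △ b)) s                  ≡⟨ parity-predecessors (a △ b) s ⟩
    parityOf dropLast (a △ b) s                      ≡⟨ △-parityOf dropLast a b s ⟩
    parityOf dropLast a s xor parityOf dropLast b s  ≡⟨ cong₂ _xor_ (parity-predecessors a s) (parity-predecessors b s) ⟨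
    parity A s xor parity B s                        ≡⟨ △-parity A B s ⟨
    parity (A △ B) s                                 ∎
  where
  open ≡-Reasoning
  A = predecessors a
  B = predecessors b

_⊕_ : Raw → Raw → Raw
x ⊕ y = (level x , proj₂ x △ proj₂ y)

Canonical : Raw → Set
Canonical x = Sorted (proj₂ x)

⊕-canonical : ∀ x {y} → Canonical y → Canonical (x ⊕ y)
⊕-canonical x = △-sorted (proj₂ x)

⊕-cancelˡ : ∀ x {y} → level y ≡ level x → Canonical y → x ⊕ (x ⊕ y) ≡ y
⊕-cancelˡ x refl cy = cong (level x ,_) (△-cancelˡ (proj₂ x) cy)

⊕-cancelʳ : ∀ {x y} e → Canonical x → Canonical y → x ⊕ e ≡ y ⊕ e → x ≡ y
⊕-cancelʳ e cx cy h = cong₂ _,_ (cong proj₁ h) (△-cancelʳ (proj₂ e) cx cy (cong proj₂ h))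

⊕-comm : ∀ x y → level x ≡ level y → Canonical x → Canonical y → x ⊕ y ≡ y ⊕ x
⊕-comm x y lxy cx cy = cong₂ _,_ lxy (△-comm cx cy)

⊕-exchange : ∀ a b c d → level a ≡ level c → Canonical b → Canonical d →
             a ⊕ d ≡ c ⊕ b → a ⊕ b ≡ c ⊕ d
⊕-exchange a b c d lac cb cd h = cong₂ _,_ lac (△-exchange (proj₂ a) (proj₂ c) cb cd (cong proj₂ h))

id-⊕ : ∀ {l} y → level y ≡ l → id l ⊕ y ≡ y
id-⊕ y refl = refl

level-p : ∀ x → level (p x) ≡ pred (level x)
level-p (zero        , _) = refl
level-p (suc zero    , _) = refl
level-p (suc (suc n) , _) = refl

level-pIter : ∀ k x → level (pIter k x) ≡ level x ∸ k
level-pIter zero    x = refl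
level-pIter (suc k) x =
  trans (level-p (pIter k x)) (trans (cong pred (level-pIter k x)) (pred[m∸n]≡m∸[1+n] (level x) k))

p-canonical : ∀ x → Canonical (p x)
p-canonical (zero        , _) = []
p-canonical (suc zero    , _) = []
p-canonical (suc (suc n) , a) = predecessors-sorted a

pIter-canonical : ∀ k {x} → Canonical x → Canonical (pIter k x)
pIter-canonical zero        cx = cx
pIter-canonical (suc k) {x} cx = p-canonical (pIter k x)

p-⊕ : ∀ x y → level y ≡ level x → p (x ⊕ y) ≡ p x ⊕ p y
p-⊕ (zero        , _) _ refl = refl
p-⊕ (suc zero    , _) _ refl = refl
p-⊕ (suc (suc n) , a) (_ , b) refl = cong (suc n ,_) (predecessors-△ a b)

pIter-⊕ : ∀ k x y → level y ≡ level x → pIter k (x ⊕ y) ≡ pIter k x ⊕ pIter k y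
pIter-⊕ zero    x y ly = refl
pIter-⊕ (suc k) x y ly = trans (cong p (pIter-⊕ k x y ly))
  (p-⊕ (pIter k x) (pIter k y) (trans (level-pIter k y) (trans (cong (_∸ k) ly) (sym (level-pIter k x)))))

pIter-+ : ∀ j i x → pIter j (pIter i x) ≡ pIter (j + i) x
pIter-+ zero    i x = refl
pIter-+ (suc j) i x = cong p (pIter-+ j i x)

pIter-id : ∀ k n → pIter k (id n) ≡ id (n ∸ k)
pIter-id zero    n = refl
pIter-id (suc k) n = trans (cong p (pIter-id k n)) (trans (p-id (n ∸ k)) (cong id (pred[m∸n]≡m∸[1+n] n k)))
  where
  p-id : ∀ m → p (id m) ≡ id (pred m)
  p-id zero          = refl
  p-id (suc zero)    = refl
  p-id (suc (suc m)) = refl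

π : ℕ → Raw → Raw
π L x = pIter (level x ∸ L) x

level-π : ∀ {L} x → L ≤ level x → level (π L x) ≡ L
level-π {L} x L≤x = trans (level-pIter (level x ∸ L) x) (m∸[m∸n]≡n L≤x)

π-level : ∀ x → π (level x) x ≡ x
π-level x rewrite n∸n≡0 (level x) = refl

π-canonical : ∀ L {x} → Canonical x → Canonical (π L x)
π-canonical L {x} = pIter-canonical (level x ∸ L)

π-π : ∀ {L M} x → L ≤ M → M ≤ level x → π L (π M x) ≡ π L x
π-π {L} {M} x L≤M M≤x rewrite level-π x M≤x =
  trans (pIter-+ (M ∸ L) (level x ∸ M) x) (cong (λ k → pIter k x) steps)
  where
  steps : (M ∸ L) + (level x ∸ M) ≡ level x ∸ L
  steps = begin
    (M ∸ L) + (level x ∸ M)   ≡⟨ +-comm (M ∸ L) (level x ∸ M) ⟩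
    (level x ∸ M) + (M ∸ L)   ≡⟨ +-∸-assoc (level x ∸ M) L≤M ⟨
    (level x ∸ M) + M ∸ L     ≡⟨ cong (_∸ L) (m∸n+n≡m M≤x) ⟩
    level x ∸ L               ∎
    where open ≡-Reasoning

π-⊕ : ∀ L x y → level y ≡ level x → π L (x ⊕ y) ≡ π L x ⊕ π L y
π-⊕ L x y refl = pIter-⊕ (level x ∸ L) x y refl

π-id : ∀ {L n} → L ≤ n → π L (id n) ≡ id L
π-id {L} {n} L≤n = trans (pIter-id (n ∸ L) n) (cong id (m∸[m∸n]≡n L≤n))

f-below : ∀ a b → level a ≤ level b → f a b ≡ a ⊕ π (level a) b
f-below a b a≤b rewrite m≤n⇒m⊓n≡m a≤b | n∸n≡0 (level a) = refl

f-above : ∀ a b → level b ≤ level a → f a b ≡ π (level b) a ⊕ b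
f-above a b b≤a rewrite m≥n⇒m⊓n≡n b≤a | n∸n≡0 (level b) | level-π a b≤a = refl

f-id : ∀ {L} x → L ≤ level x → f (id L) x ≡ π L x
f-id {L} x L≤x = trans (f-below (id L) x L≤x) (id-⊕ (π L x) (level-π x L≤x))

f-id-level : ∀ x → f (id (level x)) x ≡ x
f-id-level x = trans (f-id x ≤-refl) (π-level x)

f-id-fixed : ∀ {L} x → f (id L) x ≡ x → level x ≤ L
f-id-fixed x h = m⊓n≡n⇒n≤m (cong level h)

f-π : ∀ {L} a b → L ≤ level a → L ≤ level b → f a (π L b) ≡ π L a ⊕ π L b
f-π {L} a b L≤a L≤b =
  trans (f-above a (π L b) (subst (_≤ level a) (sym (level-π b L≤b)) L≤a))
        (cong (λ M → π M a ⊕ π L b) (level-π b L≤b))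

f-id-id : ∀ {l n} → l ≤ n → f (id l) (id n) ≡ id l
f-id-id l≤n = trans (f-id _ l≤n) (π-id l≤n)

f-same-level : ∀ a b → level b ≡ level a → f a b ≡ a ⊕ b
f-same-level a b lb =
  trans (f-above a b (≤-reflexive lb)) (cong (_⊕ b) (trans (cong (λ L → π L a) lb) (π-level a)))

f-self : ∀ a → Canonical a → f a a ≡ id (level a)
f-self a ca = trans (f-same-level a a refl) (cong (level a ,_) (△-self ca))

f-id-right : ∀ a → Canonical a → f a (id (level a)) ≡ a
f-id-right a ca = trans (f-same-level a (id (level a)) refl) (cong (level a ,_) (△-identityʳ ca))

f-⊕-cancel : ∀ a e → level e ≡ level a → Canonical e → f a (a ⊕ e) ≡ e
f-⊕-cancel a e le ce = trans (f-same-level a (a ⊕ e) refl) (⊕-cancelˡ a le ce)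

f-⊕ : ∀ a x e → level e ≡ level x → Canonical e → f a (x ⊕ e) ≡ f a x ⊕ π (level a ⊓ level x) e
f-⊕ a x@(l , _) e@(.l , _) refl ce = begin
  f a (x ⊕ e)                        ≡⟨ cong (λ z → (k , A △ proj₂ z)) (pIter-⊕ j x e refl) ⟩
  (k , A △ (proj₂ (pIter j x) △ E))  ≡⟨ cong (k ,_) (△-assoc A (proj₂ (pIter j x)) (pIter-canonical j ce)) ⟨
  f a x ⊕ π k e                      ∎
  where
  open ≡-Reasoning
  k = level a ⊓ l
  j = l ∸ k
  A = proj₂ (π k a)
  E = proj₂ (pIter j e)

Valid⇒Canonical : ∀ {T} x → Valid T x → Canonical x
Valid⇒Canonical (zero  , _) refl        = []
Valid⇒Canonical (suc n , _) (_ , linked) = Linked⇒Sorted linked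

Valid⇒Canonicalᵛ : ∀ {T k} {u : Vec Raw k} → All (Valid T) u → All Canonical u
Valid⇒Canonicalᵛ = VecAll.map (λ {x} → Valid⇒Canonical x)

⊕-valid : ∀ {T} x y → level y ≡ level x → Valid T x → Valid T y → Valid T (x ⊕ y)
⊕-valid (zero  , _) _       refl refl          refl          = refl
⊕-valid (suc n , a) (_ , b) refl (a-nodes , _) (b-nodes , b-sorted) =
  △-All a a-nodes b-nodes , AllPairs⇒Linked (△-sorted a (Linked⇒Sorted b-sorted))

NodeOf : Tree → ℕ → Node → Set
NodeOf T n t = (length t ≡ n) × (mem T t ≡ true)

dropLast-∷ʳ : ∀ s x → dropLast (s ∷ʳˡ x) ≡ s
dropLast-∷ʳ []          x = refl
dropLast-∷ʳ (y ∷ [])    x = refl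
dropLast-∷ʳ (y ∷ z ∷ s) x = cong (y ∷_) (dropLast-∷ʳ (z ∷ s) x)

dropLast-node : ∀ T n t → NodeOf T (suc (suc n)) t → NodeOf T (suc n) (dropLast t)
dropLast-node T n t (len , t∈T) with initLast t
... | []      with () ← len
... | s ∷ʳ′ x rewrite dropLast-∷ʳ s x =
  suc-injective (trans (sym (trans (List.length-++ s) (+-comm (length s) 1))) len) , closed T s x t∈T

predecessors-nodes : ∀ T n a → ListAll.All (NodeOf T (suc (suc n))) a →
                     ListAll.All (NodeOf T (suc n)) (predecessors a)
predecessors-nodes T n []      []          = []
predecessors-nodes T n (t ∷ a) (t∈ ∷ a∈) =
  toggle-All (predecessors a) (dropLast-node T n t t∈) (predecessors-nodes T n a a∈)

p-valid : ∀ {T} x → Valid T x → Valid T (p x)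
p-valid (zero        , _) _ = refl
p-valid (suc zero    , _) _ = refl
p-valid {T} (suc (suc n) , a) (a-nodes , _) =
  predecessors-nodes T n a a-nodes , AllPairs⇒Linked (predecessors-sorted a)

pIter-valid : ∀ {T} k x → Valid T x → Valid T (pIter k x)
pIter-valid zero    x vx = vx
pIter-valid (suc k) x vx = p-valid (pIter k x) (pIter-valid k x vx)

π-valid : ∀ {T} L x → Valid T x → Valid T (π L x)
π-valid L x = pIter-valid (level x ∸ L) x

id-valid : ∀ T n → Valid T (id n)
id-valid T zero    = refl
id-valid T (suc n) = [] , AllPairs⇒Linked []

f-valid : ∀ {T} a b → Valid T a → Valid T b → Valid T (f a b)
f-valid {T} a b va vb = subst (Valid T) (cong (_, proj₂ (f a b)) (level-π a k≤a))
  (⊕-valid (π k a) (π k b) (trans (level-π b k≤b) (sym (level-π a k≤a))) (π-valid k a va) (π-valid k b vb))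
  where
  k = level a ⊓ level b
  k≤a = m⊓n≤m (level a) (level b)
  k≤b = m⊓n≤n (level a) (level b)

f-canonical : ∀ a {b} → Canonical b → Canonical (f a b)
f-canonical a {b} cb = △-sorted (proj₂ (π (level a ⊓ level b) a)) (π-canonical (level a ⊓ level b) cb)

_⊕ᵛ_ : ∀ {k} → Vec Raw k → Vec Raw k → Vec Raw k
_⊕ᵛ_ = zipWith _⊕_

levels : ∀ {k} → Vec Raw k → Vec ℕ k
levels = map level

SameLevels : ∀ {k} → Vec Raw k → Vec Raw k → Set
SameLevels u v = ∀ i → level (lookup u i) ≡ level (lookup v i)

levels⇒SameLevels : ∀ {k} {u v : Vec Raw k} → levels u ≡ levels v → SameLevels u v
levels⇒SameLevels {u = u} {v} h i =
  trans (sym (lookup-map i level u)) (trans (cong (λ w → lookup w i) h) (lookup-map i level v))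

⊕ᵛ-canonical : ∀ {k} (u : Vec Raw k) {v} → All Canonical v → All Canonical (u ⊕ᵛ v)
⊕ᵛ-canonical []      {[]}    []        = []
⊕ᵛ-canonical (x ∷ u) {y ∷ v} (cy ∷ cv) = ⊕-canonical x {y} cy ∷ ⊕ᵛ-canonical u cv

⊕ᵛ-valid : ∀ {T k} {u v : Vec Raw k} → SameLevels v u →
           All (Valid T) u → All (Valid T) v → All (Valid T) (u ⊕ᵛ v)
⊕ᵛ-valid h []        []        = []
⊕ᵛ-valid h (vx ∷ vu) (vy ∷ vv) = ⊕-valid _ _ (h zero) vx vy ∷ ⊕ᵛ-valid (λ i → h (suc i)) vu vv

ids : ∀ {k} → Vec Raw k → Vec Raw k
ids = map (λ x → id (level x))

ids-valid : ∀ T {k} (u : Vec Raw k) → All (Valid T) (ids u)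
ids-valid T u = map⁺ (VecAll.universal (λ x → id-valid T (level x)) u)

levels-ids : ∀ {k} (u : Vec Raw k) → levels (ids u) ≡ levels u
levels-ids u = sym (map-∘ level (λ x → id (level x)) u)

ids-⊕ᵛ : ∀ {k} (u v : Vec Raw k) → SameLevels v u → ids u ⊕ᵛ v ≡ v
ids-⊕ᵛ []      []      _ = refl
ids-⊕ᵛ (x ∷ u) (y ∷ v) h = cong₂ _∷_ (id-⊕ y (h zero)) (ids-⊕ᵛ u v (λ i → h (suc i)))

projections : ∀ {k} → Raw → Vec Raw k → Vec Raw k
projections y u = map (λ x → f (id (level x)) y) u

projections-id : ∀ {k n} (u : Vec Raw k) → All (λ x → level x ≤ n) u → projections (id n) u ≡ ids u
projections-id []      []          = refl
projections-id (x ∷ u) (x≤n ∷ u≤n) = cong₂ _∷_ (f-id-id x≤n) (projections-id u u≤n)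

SameLevels-projections : ∀ {k} y (u : Vec Raw k) → All (λ x → level x ≤ level y) u →
                         SameLevels (projections y u) u
SameLevels-projections y u u≤y i =
  trans (cong level (lookup-map i (λ x → f (id (level x)) y) u)) (m≤n⇒m⊓n≡m (lookup⁺ u≤y i))

projections-valid : ∀ {T k} {y} (u : Vec Raw k) → Valid T y → All (Valid T) (projections y u)
projections-valid {T} {y = y} u vy =
  map⁺ (VecAll.universal (λ x → f-valid (id (level x)) y (id-valid T (level x)) vy) u)

lookup-projections : ∀ {k} y (u : Vec Raw k) i → level (lookup u i) ≡ level y → lookup (projections y u) i ≡ y
lookup-projections y u i top =
  trans (lookup-map i (λ x → f (id (level x)) y) u) (trans (cong (λ l → f (id l) y) top) (f-id-level y))

SameLevels-⊕ᵛ : ∀ {k} (u v : Vec Raw k) → SameLevels (u ⊕ᵛ v) u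
SameLevels-⊕ᵛ u v i = cong level (lookup-zipWith _⊕_ i u v)

Coherent : ∀ {k} → Vec Raw k → Set
Coherent e = ∀ i j {L} → L ≤ level (lookup e i) → L ≤ level (lookup e j) →
             π L (lookup e i) ≡ π L (lookup e j)

module _ {T : Tree} where

  varOf : ∀ {k} → Term T k → Fin k
  varOf (var i)     = i
  varOf (app _ _ t) = varOf t

  level-eval : ∀ {k} (t : Term T k) u → level (eval t u) ≤ level (lookup u (varOf t))
  level-eval (var i)     u = ≤-refl
  level-eval (app a _ t) u = ≤-trans (m⊓n≤n (level a) _) (level-eval t u)

  eval-canonical : ∀ {k} (t : Term T k) {u} → All Canonical u → Canonical (eval t u)
  eval-canonical (var i)     cu = lookup⁺ cu i
  eval-canonical (app a _ t) cu = f-canonical a (eval-canonical t cu)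

  eval-⊕ᵛ : ∀ {k} (t : Term T k) u e → SameLevels e u → All Canonical e →
            eval t (u ⊕ᵛ e) ≡ eval t u ⊕ π (level (eval t u)) (lookup e (varOf t))
  eval-⊕ᵛ (var i) u e le ce = begin
    lookup (u ⊕ᵛ e) i                                 ≡⟨ lookup-zipWith _⊕_ i u e ⟩
    lookup u i ⊕ lookup e i                           ≡⟨ cong (lookup u i ⊕_) (π-level (lookup e i)) ⟨
    lookup u i ⊕ π (level (lookup e i)) (lookup e i)  ≡⟨ cong (λ L → lookup u i ⊕ π L (lookup e i)) (le i) ⟩
    lookup u i ⊕ π (level (lookup u i)) (lookup e i)  ∎
    where open ≡-Reasoning
  eval-⊕ᵛ (app a _ t) u e le ce = begin
    f a (eval t (u ⊕ᵛ e))        ≡⟨ cong (f a) (eval-⊕ᵛ t u e le ce) ⟩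
    f a (x ⊕ π (level x) ei)     ≡⟨ f-⊕ a x (π (level x) ei) (level-π ei x≤ei) (π-canonical (level x) (lookup⁺ ce _)) ⟩
    f a x ⊕ π k (π (level x) ei) ≡⟨ cong (f a x ⊕_) (π-π ei (m⊓n≤n (level a) (level x)) x≤ei) ⟩
    f a x ⊕ π k ei               ∎
    where
    open ≡-Reasoning
    x = eval t u
    ei = lookup e (varOf t)
    k = level a ⊓ level x
    x≤ei : level x ≤ level ei
    x≤ei = subst (level x ≤_) (sym (le (varOf t))) (level-eval t u)

  QF-translate : ∀ {k} (u e : Vec Raw k) → All Canonical u → SameLevels e u → All Canonical e → Coherent e →
                 QFEq T u (u ⊕ᵛ e)
  QF-translate u e cu le ce coh s t = forth , back
    where
    shift : ∀ r → eval r (u ⊕ᵛ e) ≡ eval r u ⊕ π (level (eval r u)) (lookup e (varOf r))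
    shift r = eval-⊕ᵛ r u e le ce
    below : ∀ r → level (eval r u) ≤ level (lookup e (varOf r))
    below r = subst (level (eval r u) ≤_) (sym (le (varOf r))) (level-eval r u)
    agree : level (eval s u) ≡ level (eval t u) →
            π (level (eval s u)) (lookup e (varOf s)) ≡ π (level (eval t u)) (lookup e (varOf t))
    agree l≡ = trans (coh (varOf s) (varOf t) (below s) (subst (_≤ _) (sym l≡) (below t)))
                     (cong (λ L → π L (lookup e (varOf t))) l≡)
    forth : eval s u ≡ eval t u → eval s (u ⊕ᵛ e) ≡ eval t (u ⊕ᵛ e)
    forth h = trans (shift s) (trans (cong₂ _⊕_ h (agree (cong level h))) (sym (shift t)))
    back : eval s (u ⊕ᵛ e) ≡ eval t (u ⊕ᵛ e) → eval s u ≡ eval t u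
    back h = ⊕-cancelʳ (π (level (eval s u)) (lookup e (varOf s))) (eval-canonical s cu) (eval-canonical t cu)
               (trans h′ (cong (eval t u ⊕_) (sym (agree (cong level h′)))))
      where
      h′ = trans (sym (shift s)) (trans h (shift t))

  QF⇒SameLevels : ∀ {k} {u v : Vec Raw k} → QFEq T u v → SameLevels v u
  QF⇒SameLevels {u = u} {v} qf i = ≤-antisym
    (f-id-fixed (lookup v i) (proj₁ (qf (cut (level (lookup u i))) (var i)) (f-id-level (lookup u i))))
    (f-id-fixed (lookup u i) (proj₂ (qf (cut (level (lookup v i))) (var i)) (f-id-level (lookup v i))))
    where
    cut : ℕ → Term T _
    cut L = app (id L) (id-valid T L) (var i)

  QF-cross : ∀ {k} {u v : Vec Raw k} → QFEq T u v → All (Valid T) u → ∀ i j {L} →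
             L ≤ level (lookup u i) → L ≤ level (lookup u j) →
             π L (lookup u j) ⊕ π L (lookup v i) ≡ π L (lookup u i) ⊕ π L (lookup v j)
  QF-cross {u = u} {v} qf vu i j {L} L≤ui L≤uj =
    trans (sym (cross uj vi L≤uj L≤vi)) (trans (proj₁ (qf s t) at-u) (cross ui vj L≤ui L≤vj))
    where
    ui = lookup u i
    uj = lookup u j
    vi = lookup v i
    vj = lookup v j
    L≤vi : L ≤ level vi
    L≤vi = subst (L ≤_) (sym (QF⇒SameLevels qf i)) L≤ui
    L≤vj : L ≤ level vj
    L≤vj = subst (L ≤_) (sym (QF⇒SameLevels qf j)) L≤uj
    cross : ∀ a b → L ≤ level a → L ≤ level b → f a (f (id L) b) ≡ π L a ⊕ π L b
    cross a b L≤a L≤b = trans (cong (f a) (f-id b L≤b)) (f-π a b L≤a L≤b)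
    s t : Term T _
    s = app uj (lookup⁺ vu j) (app (id L) (id-valid T L) (var i))
    t = app ui (lookup⁺ vu i) (app (id L) (id-valid T L) (var j))
    at-u : eval s u ≡ eval t u
    at-u = trans (cross uj ui L≤uj L≤ui)
          (trans (⊕-comm (π L uj) (π L ui) (trans (level-π uj L≤uj) (sym (level-π ui L≤ui)))
                   (π-canonical L (Valid⇒Canonical uj (lookup⁺ vu j)))
                   (π-canonical L (Valid⇒Canonical ui (lookup⁺ vu i))))
          (sym (cross ui uj L≤ui L≤uj)))

  QF⇒Coherent : ∀ {k} {u v : Vec Raw k} → QFEq T u v → All (Valid T) u → All Canonical v → Coherent (u ⊕ᵛ v)
  QF⇒Coherent {u = u} {v} qf vu cv i j {L} L≤i L≤j = begin
    π L (lookup (u ⊕ᵛ v) i)  ≡⟨ cong (π L) (lookup-zipWith _⊕_ i u v) ⟩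
    π L (ui ⊕ vi)            ≡⟨ π-⊕ L ui vi (QF⇒SameLevels qf i) ⟩
    π L ui ⊕ π L vi          ≡⟨ exchanged ⟨
    π L uj ⊕ π L vj          ≡⟨ π-⊕ L uj vj (QF⇒SameLevels qf j) ⟨
    π L (uj ⊕ vj)            ≡⟨ cong (π L) (lookup-zipWith _⊕_ j u v) ⟨
    π L (lookup (u ⊕ᵛ v) j)  ∎
    where
    open ≡-Reasoning
    ui = lookup u i
    uj = lookup u j
    vi = lookup v i
    vj = lookup v j
    L≤ui : L ≤ level ui
    L≤ui = subst (L ≤_) (SameLevels-⊕ᵛ u v i) L≤i
    L≤uj : L ≤ level uj
    L≤uj = subst (L ≤_) (SameLevels-⊕ᵛ u v j) L≤j
    exchanged : π L uj ⊕ π L vj ≡ π L ui ⊕ π L vi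
    exchanged = ⊕-exchange (π L uj) (π L vj) (π L ui) (π L vi)
      (trans (level-π uj L≤uj) (sym (level-π ui L≤ui)))
      (π-canonical L (lookup⁺ cv j)) (π-canonical L (lookup⁺ cv i)) (QF-cross qf vu i j L≤ui L≤uj)

  BF⇒QF : ∀ β {k} {u v : Vec Raw k} → BF T β u v → QFEq T u v
  BF⇒QF oz     h       = h
  BF⇒QF (os β) (_ , h) = BF⇒QF β h
  BF⇒QF (ol g) h       = BF⇒QF (g 0) (h 0)

  module _ (Sim : ∀ {k m} → Vec Raw k → Vec Raw k → Vec Raw m → Vec Raw m → Set)
           (Sim-QF : ∀ {k m} {u v : Vec Raw k} {u′ v′ : Vec Raw m} →
                     Sim u v u′ v′ → QFEq T u v → QFEq T u′ v′)
           (Sim-∷ʳ : ∀ {k m} {u v : Vec Raw k} {u′ v′ : Vec Raw m} {c d} → Valid T c → Valid T d →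
                     QFEq T (u ∷ʳ c) (v ∷ʳ d) → Sim u v u′ v′ → Sim (u ∷ʳ c) (v ∷ʳ d) (u′ ∷ʳ c) (v′ ∷ʳ d))
    where

    BF-simulate : ∀ β {k m} {u v : Vec Raw k} {u′ v′ : Vec Raw m} →
                  Sim u v u′ v′ → BF T β u v → BF T β u′ v′
    BF-simulate oz     sim h   = Sim-QF sim h
    BF-simulate (ol g) sim h n = BF-simulate (g n) sim (h n)
    BF-simulate (os β) {u = u} {v} {u′} {v′} sim ((forth , back) , h) = (forth′ , back′) , BF-simulate β sim h
      where
      extend : ∀ {c d} → Valid T c → Valid T d → BF T β (u ∷ʳ c) (v ∷ʳ d) → BF T β (u′ ∷ʳ c) (v′ ∷ʳ d)
      extend vc vd h′ = BF-simulate β (Sim-∷ʳ vc vd (BF⇒QF β h′) sim) h′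
      forth′ : ∀ c → Valid T c → ∃ λ d → Valid T d × BF T β (u′ ∷ʳ c) (v′ ∷ʳ d)
      forth′ c vc with forth c vc
      ... | d , vd , h′ = d , vd , extend vc vd h′
      back′ : ∀ d → Valid T d → ∃ λ c → Valid T c × BF T β (u′ ∷ʳ c) (v′ ∷ʳ d)
      back′ d vd with back d vd
      ... | c , vc , h′ = c , vc , extend vc vd h′

  data Translation : ∀ {k m} → Vec Raw k → Vec Raw k → Vec Raw m → Vec Raw m → Set where
    translation : ∀ {k} {u v u′ : Vec Raw k} → All (Valid T) u → All (Valid T) v → All (Valid T) u′ →
                  levels u′ ≡ levels u → Translation u v u′ (u′ ⊕ᵛ (u ⊕ᵛ v))

  Translation-QF : ∀ {k m} {u v : Vec Raw k} {u′ v′ : Vec Raw m} →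
                   Translation u v u′ v′ → QFEq T u v → QFEq T u′ v′
  Translation-QF {u = u} {v} {u′} (translation vu vv vu′ lev) qf =
    QF-translate u′ (u ⊕ᵛ v) (Valid⇒Canonicalᵛ vu′)
      (λ i → trans (SameLevels-⊕ᵛ u v i) (sym (levels⇒SameLevels lev i)))
      (⊕ᵛ-canonical u (Valid⇒Canonicalᵛ vv)) (QF⇒Coherent qf vu (Valid⇒Canonicalᵛ vv))

  Translation-∷ʳ : ∀ {k m} {u v : Vec Raw k} {u′ v′ : Vec Raw m} {c d} → Valid T c → Valid T d →
                   QFEq T (u ∷ʳ c) (v ∷ʳ d) → Translation u v u′ v′ →
                   Translation (u ∷ʳ c) (v ∷ʳ d) (u′ ∷ʳ c) (v′ ∷ʳ d)
  Translation-∷ʳ {c = c} {d} vc vd qf (translation {k} {u} {v} {u′} vu vv vu′ lev) =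
    subst (Translation (u ∷ʳ c) (v ∷ʳ d) (u′ ∷ʳ c)) shifted
      (translation (All-∷ʳ vu vc) (All-∷ʳ vv vd) (All-∷ʳ vu′ vc) levels-∷ʳ)
    where
    open ≡-Reasoning
    levels-∷ʳ : levels (u′ ∷ʳ c) ≡ levels (u ∷ʳ c)
    levels-∷ʳ = trans (map-∷ʳ level c u′) (trans (cong (_∷ʳ level c) lev) (sym (map-∷ʳ level c u)))
    d≈c : level d ≡ level c
    d≈c = begin
      level d                          ≡⟨ cong level (lookup-∷ʳ-last v d) ⟨
      level (lookup (v ∷ʳ d) (fromℕ k)) ≡⟨ QF⇒SameLevels qf (fromℕ k) ⟩
      level (lookup (u ∷ʳ c) (fromℕ k)) ≡⟨ cong level (lookup-∷ʳ-last u c) ⟩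
      level c                          ∎
    shifted : (u′ ∷ʳ c) ⊕ᵛ ((u ∷ʳ c) ⊕ᵛ (v ∷ʳ d)) ≡ (u′ ⊕ᵛ (u ⊕ᵛ v)) ∷ʳ d
    shifted = begin
      (u′ ∷ʳ c) ⊕ᵛ ((u ∷ʳ c) ⊕ᵛ (v ∷ʳ d)) ≡⟨ cong ((u′ ∷ʳ c) ⊕ᵛ_) (zipWith-∷ʳ _⊕_ u v c d) ⟩
      (u′ ∷ʳ c) ⊕ᵛ ((u ⊕ᵛ v) ∷ʳ (c ⊕ d))  ≡⟨ zipWith-∷ʳ _⊕_ u′ (u ⊕ᵛ v) c (c ⊕ d) ⟩
      (u′ ⊕ᵛ (u ⊕ᵛ v)) ∷ʳ (c ⊕ (c ⊕ d))    ≡⟨ cong (_ ∷ʳ_) (⊕-cancelˡ c d≈c (Valid⇒Canonical d vd)) ⟩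
      (u′ ⊕ᵛ (u ⊕ᵛ v)) ∷ʳ d                ∎

  BF-translate : ∀ β {k} {u v u′ : Vec Raw k} → All (Valid T) u → All (Valid T) v → All (Valid T) u′ →
                 levels u′ ≡ levels u → BF T β u v → BF T β u′ (u′ ⊕ᵛ (u ⊕ᵛ v))
  BF-translate β vu vv vu′ lev =
    BF-simulate Translation Translation-QF Translation-∷ʳ β (translation vu vv vu′ lev)

  evalᵛ : ∀ {k m} → Vec (Term T k) m → Vec Raw k → Vec Raw m
  evalᵛ w u = map (λ t → eval t u) w

  _[_] : ∀ {k m} → Term T m → Vec (Term T k) m → Term T k
  var i      [ w ] = lookup w i
  app a va t [ w ] = app a va (t [ w ])

  eval-[] : ∀ {k m} (t : Term T m) (w : Vec (Term T k) m) u → eval (t [ w ]) u ≡ eval t (evalᵛ w u)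
  eval-[] (var i)     w u = sym (lookup-map i (λ t → eval t u) w)
  eval-[] (app a _ t) w u = cong (f a) (eval-[] t w u)

  QF-evalᵛ : ∀ {k m} (w : Vec (Term T k) m) {u v} → QFEq T u v → QFEq T (evalᵛ w u) (evalᵛ w v)
  QF-evalᵛ w {u} {v} qf s t = forth , back
    where
    forth : eval s (evalᵛ w u) ≡ eval t (evalᵛ w u) → eval s (evalᵛ w v) ≡ eval t (evalᵛ w v)
    forth h = subst₂ _≡_ (eval-[] s w v) (eval-[] t w v)
      (proj₁ (qf (s [ w ]) (t [ w ])) (subst₂ _≡_ (sym (eval-[] s w u)) (sym (eval-[] t w u)) h))
    back : eval s (evalᵛ w v) ≡ eval t (evalᵛ w v) → eval s (evalᵛ w u) ≡ eval t (evalᵛ w u)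
    back h = subst₂ _≡_ (eval-[] s w u) (eval-[] t w u)
      (proj₂ (qf (s [ w ]) (t [ w ])) (subst₂ _≡_ (sym (eval-[] s w v)) (sym (eval-[] t w v)) h))

  weaken : ∀ {k} → Term T k → Term T (suc k)
  weaken (var i)      = var (inject₁ i)
  weaken (app a va t) = app a va (weaken t)

  eval-weaken : ∀ {k} (t : Term T k) u c → eval (weaken t) (u ∷ʳ c) ≡ eval t u
  eval-weaken (var i)     u c = lookup-∷ʳ-inject₁ u c i
  eval-weaken (app a _ t) u c = cong (f a) (eval-weaken t u c)

  extend : ∀ {k m} → Vec (Term T k) m → Vec (Term T (suc k)) (suc m)
  extend {k} w = map weaken w ∷ʳ var (fromℕ k)

  evalᵛ-extend : ∀ {k m} (w : Vec (Term T k) m) u c → evalᵛ (extend w) (u ∷ʳ c) ≡ evalᵛ w u ∷ʳ c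
  evalᵛ-extend []      u c = cong (_∷ []) (lookup-∷ʳ-last u c)
  evalᵛ-extend (t ∷ w) u c = cong₂ _∷_ (eval-weaken t u c) (evalᵛ-extend w u c)

  data Substitution : ∀ {k m} → Vec Raw k → Vec Raw k → Vec Raw m → Vec Raw m → Set where
    substitution : ∀ {k m} {u v : Vec Raw k} (w : Vec (Term T k) m) → Substitution u v (evalᵛ w u) (evalᵛ w v)

  Substitution-QF : ∀ {k m} {u v : Vec Raw k} {u′ v′ : Vec Raw m} →
                    Substitution u v u′ v′ → QFEq T u v → QFEq T u′ v′
  Substitution-QF (substitution w) = QF-evalᵛ w

  Substitution-∷ʳ : ∀ {k m} {u v : Vec Raw k} {u′ v′ : Vec Raw m} {c d} → Valid T c → Valid T d →
                    QFEq T (u ∷ʳ c) (v ∷ʳ d) → Substitution u v u′ v′ →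
                    Substitution (u ∷ʳ c) (v ∷ʳ d) (u′ ∷ʳ c) (v′ ∷ʳ d)
  Substitution-∷ʳ {c = c} {d} _ _ _ (substitution {u = u} {v} w) =
    subst₂ (Substitution (u ∷ʳ c) (v ∷ʳ d)) (evalᵛ-extend w u c) (evalᵛ-extend w v d) (substitution (extend w))

  BF-evalᵛ : ∀ β {k m} (w : Vec (Term T k) m) {u v} → BF T β u v → BF T β (evalᵛ w u) (evalᵛ w v)
  BF-evalᵛ β w = BF-simulate Substitution Substitution-QF Substitution-∷ʳ β (substitution w)

  BF-projections : ∀ β {k} (u : Vec Raw k) {y z} →
                   BF T β (y ∷ []) (z ∷ []) → BF T β (projections y u) (projections z u)
  BF-projections β u {y} {z} h =
    subst₂ (BF T β) (evalᵛ-projectionTerms y) (evalᵛ-projectionTerms z) (BF-evalᵛ β (map projectionTerm u) h)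
    where
    projectionTerm : Raw → Term T 1
    projectionTerm x = app (id (level x)) (id-valid T (level x)) (var zero)
    evalᵛ-projectionTerms : ∀ y → evalᵛ (map projectionTerm u) (y ∷ []) ≡ projections y u
    evalᵛ-projectionTerms y = sym (map-∘ (λ t → eval t (y ∷ [])) projectionTerm u)

  module _ (A : Automorphism T) where
    open Automorphism A

    σ-id-level : ∀ a → Valid T a → σ (id (level a)) ≡ f a (σ a)
    σ-id-level a va = trans (cong σ (sym (f-self a (Valid⇒Canonical a va)))) (hom a a va va)

    σ-via-id-level : ∀ a → Valid T a → σ a ≡ f a (σ (id (level a)))
    σ-via-id-level a va =
      trans (cong σ (sym (f-id-right a (Valid⇒Canonical a va)))) (hom a (id (level a)) va (id-valid T (level a)))

    σ-id-≤ : ∀ {l n} → l ≤ n → σ (id l) ≡ f (id l) (σ (id n))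
    σ-id-≤ {l} {n} l≤n = trans (cong σ (sym (f-id-id l≤n))) (hom (id l) (id n) (id-valid T l) (id-valid T n))

  BF-top⇒BF-tuple : ∀ {k n} {as : Vec Raw k} {e} → All (Valid T) as → All (λ x → level x ≤ n) as →
                    Valid T e → level e ≡ n → ∀ β → BF T β (id n ∷ []) (e ∷ []) →
                    BF T β as (as ⊕ᵛ projections e as)
  BF-top⇒BF-tuple {as = as} {e} vas below ve level-e β id≡e =
    subst (λ w → BF T β as (as ⊕ᵛ w)) (ids-⊕ᵛ as es (SameLevels-projections e as below-e))
      (BF-translate β (ids-valid T as) (projections-valid as ve) vas (sym (levels-ids as)) ids≡es)
    where
    es = projections e as
    below-e : All (λ x → level x ≤ level e) as
    below-e = VecAll.map (λ {x} → subst (level x ≤_) (sym level-e)) below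
    ids≡es : BF T β (ids as) es
    ids≡es = subst (λ w → BF T β w es) (projections-id as below) (BF-projections β as id≡e)

  BF-tuple⇒BF-top : ∀ {k n} {as bs : Vec Raw k} → All (Valid T) as → All (Valid T) bs →
                    (top : Any (λ x → level x ≡ n) as) → ∀ β → BF T β as bs →
                    BF T β (id n ∷ []) (lookup (as ⊕ᵛ bs) (Any.index top) ∷ [])
  BF-tuple⇒BF-top {as = as} {bs} vas vbs top β as≡bs =
    subst (λ x → BF T β (x ∷ []) (ei ∷ [])) (trans (lookup-map i _ as) (cong id (lookup-index top)))
      (BF-evalᵛ β (var i ∷ []) ids≡es)
    where
    es = as ⊕ᵛ bs
    i = Any.index top
    ei = lookup es i
    ids≡es : BF T β (ids as) es
    ids≡es = subst (BF T β (ids as)) (ids-⊕ᵛ as es (SameLevels-⊕ᵛ as bs))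
      (BF-translate β vas vbs (ids-valid T as) (levels-ids as) as≡bs)

  SRCond-tuple⇒id : ∀ {k n} {as : Vec Raw k} → All (Valid T) as → Any (λ x → level x ≡ n) as →
                    All (λ x → level x ≤ n) as → ∀ β → SRCond T as β → SRCond T (id n ∷ []) β
  SRCond-tuple⇒id {n = n} {as} vas top below β sr (e ∷ []) (ve ∷ []) id≡e = A , cong (_∷ []) σ-id-n
    where
    open ≡-Reasoning
    level-e : level e ≡ n
    level-e = QF⇒SameLevels (BF⇒QF β id≡e) zero
    es = projections e as
    same : SameLevels es as
    same = SameLevels-projections e as (VecAll.map (λ {x} → subst (level x ≤_) (sym level-e)) below)
    orbit = sr (as ⊕ᵛ es) (⊕ᵛ-valid same vas (projections-valid as ve)) (BF-top⇒BF-tuple vas below ve level-e β id≡e)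
    A = proj₁ orbit
    open Automorphism A
    i = Any.index top
    ai = lookup as i
    σ-ai : σ ai ≡ ai ⊕ e
    σ-ai = begin
      σ ai                  ≡⟨ lookup-map i σ as ⟨
      lookup (map σ as) i   ≡⟨ cong (λ w → lookup w i) (proj₂ orbit) ⟩
      lookup (as ⊕ᵛ es) i   ≡⟨ lookup-zipWith _⊕_ i as es ⟩
      ai ⊕ lookup es i      ≡⟨ cong (ai ⊕_) (lookup-projections e as i (trans (lookup-index top) (sym level-e))) ⟩
      ai ⊕ e                ∎
    σ-id-n : σ (id n) ≡ e
    σ-id-n = begin
      σ (id n)            ≡⟨ cong (λ l → σ (id l)) (lookup-index top) ⟨
      σ (id (level ai))   ≡⟨ σ-id-level A ai (lookup⁺ vas i) ⟩
      f ai (σ ai)         ≡⟨ cong (f ai) σ-ai ⟩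
      f ai (ai ⊕ e)       ≡⟨ f-⊕-cancel ai e (trans level-e (sym (lookup-index top))) (Valid⇒Canonical e ve) ⟩
      e                   ∎

  SRCond-id⇒tuple : ∀ {k n} {as : Vec Raw k} → All (Valid T) as → Any (λ x → level x ≡ n) as →
                    All (λ x → level x ≤ n) as → ∀ β → SRCond T (id n ∷ []) β → SRCond T as β
  SRCond-id⇒tuple {n = n} {as} vas top below β sr bs vbs as≡bs = A , ≡-lookup σ-as
    where
    open ≡-Reasoning
    qf = BF⇒QF β as≡bs
    es = as ⊕ᵛ bs
    i = Any.index top
    ei = lookup es i
    vei : Valid T ei
    vei = lookup⁺ (⊕ᵛ-valid (QF⇒SameLevels qf) vas vbs) i
    orbit = sr (ei ∷ []) (vei ∷ []) (BF-tuple⇒BF-top vas vbs top β as≡bs)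
    A = proj₁ orbit
    open Automorphism A
    σ-as : ∀ j → lookup (map σ as) j ≡ lookup bs j
    σ-as j = begin
      lookup (map σ as) j  ≡⟨ lookup-map j σ as ⟩
      σ aj                 ≡⟨ σ-via-id-level A aj (lookup⁺ vas j) ⟩
      f aj (σ (id lj))     ≡⟨ cong (f aj) σ-id-lj ⟩
      f aj ej              ≡⟨ cong (f aj) (lookup-zipWith _⊕_ j as bs) ⟩
      f aj (aj ⊕ bj)       ≡⟨ f-⊕-cancel aj bj (QF⇒SameLevels qf j) (lookup⁺ (Valid⇒Canonicalᵛ vbs) j) ⟩
      bj                   ∎
      where
      aj = lookup as j
      bj = lookup bs j
      ej = lookup es j
      lj = level aj
      level-ej : level ej ≡ lj
      level-ej = SameLevels-⊕ᵛ as bs j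
      lj≤ei : lj ≤ level ei
      lj≤ei = subst (lj ≤_) (sym (trans (SameLevels-⊕ᵛ as bs i) (lookup-index top))) (lookup⁺ below j)
      σ-id-lj : σ (id lj) ≡ ej
      σ-id-lj = begin
        σ (id lj)              ≡⟨ σ-id-≤ A (lookup⁺ below j) ⟩
        f (id lj) (σ (id n))   ≡⟨ cong (f (id lj)) (∷-injectiveˡ (proj₂ orbit)) ⟩
        f (id lj) ei           ≡⟨ f-id ei lj≤ei ⟩
        π lj ei                ≡⟨ QF⇒Coherent qf vas (Valid⇒Canonicalᵛ vbs) i j lj≤ei (≤-reflexive (sym level-ej)) ⟩
        π lj ej                ≡⟨ cong (λ L → π L ej) level-ej ⟨
        π (level ej) ej        ≡⟨ π-level ej ⟩
        ej                     ∎

IsSR-cong : ∀ {T k m} {u : Vec Raw k} {v : Vec Raw m} →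
            (∀ β → SRCond T u β ⟺ SRCond T v β) → ∀ β → IsSR T u β ⟺ IsSR T v β
IsSR-cong h β =
  (λ (sr , least) → proj₁ (h β) sr , λ γ sr′ → least γ (proj₂ (h γ) sr′)) ,
  (λ (sr , least) → proj₂ (h β) sr , λ γ sr′ → least γ (proj₁ (h γ) sr′))

lemma3p5 : (T : Tree) (k : ℕ) (as : Vec Raw k) → All (Valid T) as →
           (n : ℕ) → Any (λ x → level x ≡ n) as → All (λ x → level x ≤ n) as →
           ∀ (β : Ord) → IsSR T as β ⟺ IsSR T (id n ∷ []) β
lemma3p5 T k as vas n top below =
  IsSR-cong λ β → SRCond-tuple⇒id vas top below β , SRCond-id⇒tuple vas top below β
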